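{- Let $\mathbf E=(E;\oplus,',0,1)$ be a lattice effect algebra with lattice operations $\vee,\wedge$ (with respect to its induced order $\leq$). For $x,y\in E$ put \[ x\cdot y:=((x'\wedge y)\oplus y')'. \] Then $x\cdot y$ is well-defined for all $x,y\in E$ (since $x'\wedge y\leq y$), and $\mathbb R(\mathbf E):=(E;\cdot,',0,1)$ is an effect groupoid.
   Context: An effect algebra is a partial algebra $(E;\oplus,0,1)$ of type $(2,0,0)$ such that for all $x,y,z$: (E1) if $x\oplus y$ exists then $y\oplus x$ exists and equals it; (E2) if $x\oplus y$ and $(x\oplus y)\oplus z$ exist then $y\oplus z$ and $x\oplus(y\oplus z)$ exist and $(x\oplus y)\oplus z=x\oplus(y\oplus z)$; (E3) there is a unique $x'\in E$ with $x\oplus x'$ defined and equal to $1$; (E4) if $x\oplus 1$ exists then $x=0$. The unary operation $'$ is regarded as fundamental, writing $(E;\oplus,',0,1)$. The induced order: $a\leq b$ iff there is $c$ with $a\oplus c$ defined and $a\oplus c=b$; this makes $E$ a bounded poset with antitone involution $'$, and $a\oplus b$ exists iff $a\leq b'$. A lattice effect algebra is an effect algebra whose induced order is a lattice order. An effect groupoid is an algebra $(R;\cdot,',0,1)$ of type $(2,1,0,0)$ such that for all $x,y,z\in R$: (NG0) $1$ is a two-sided unit for $\cdot$; (NG1) $x=x''$; (NG2) $x\cdot 0=0\cdot x=0$; (NG3) $0'=1$; (NG4) $x\cdot(y\cdot x')=0=(y\cdot x')\cdot x$; (NG5) $x\cdot y=y\cdot[(y'\cdot x')'\cdot x']'$;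 (NG6) $x\cdot(y'\cdot x)'=(y'\cdot x)'\cdot x=(x'\cdot y)'\cdot y$; (NG7) $[(x\cdot y')'\cdot y']'\cdot z=[((x\cdot z)\cdot(y\cdot z)')'\cdot(y\cdot z)']'$; (NG8) if $x'\cdot y'=0$ and $(x\cdot y)'\cdot z'=0$ then $y'\cdot z'=0$, $x'\cdot(y\cdot z)'=0$ and $(x\cdot y)\cdot z=x\cdot(y\cdot z)$. -}

module Defs where

open import Level using (Level; suc; _⊔_)
open import Data.Maybe using (Maybe; just)
open import Data.Product using (Σ; ∃; _×_; _,_)
open import Relation.Binary.PropositionalEquality using (_≡_)

-- An effect algebra (E; ⊕, ', 0, 1).  The partial operation ⊕ is a total
-- function into Maybe E:  "x ⊕ y exists and equals z"  is  x ⊕ y ≡ just z.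
record EffectAlgebra (ℓ : Level) : Set (suc ℓ) where
  infixl 6 _⊕_
  infix 8 _′
  field
    Carrier : Set ℓ
    _⊕_     : Carrier → Carrier → Maybe Carrier
    _′      : Carrier → Carrier
    𝟘 𝟙     : Carrier
    E1 : ∀ x y z → x ⊕ y ≡ just z → y ⊕ x ≡ just z
    E2 : ∀ x y z u w → x ⊕ y ≡ just u → u ⊕ z ≡ just w →
         Σ Carrier λ v → (y ⊕ z ≡ just v) × (x ⊕ v ≡ just w)
    E3-exists : ∀ x → x ⊕ (x ′) ≡ just 𝟙
    E3-unique : ∀ x y → x ⊕ y ≡ just 𝟙 → y ≡ x ′
    E4 : ∀ x z → x ⊕ 𝟙 ≡ just z → x ≡ 𝟘

  _≤_ : Carrier → Carrier → Set ℓ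
  a ≤ b = Σ Carrier λ c → a ⊕ c ≡ just b

record LatticeEffectAlgebra (ℓ : Level) : Set (suc ℓ) where
  field
    effectAlgebra : EffectAlgebra ℓ
  open EffectAlgebra effectAlgebra public
  infixr 7 _∧_
  infixr 6 _∨_
  field
    _∨_ _∧_ : Carrier → Carrier → Carrier
    ∨-upperˡ : ∀ x y → x ≤ (x ∨ y)
    ∨-upperʳ : ∀ x y → y ≤ (x ∨ y)
    ∨-least  : ∀ x y z → x ≤ z → y ≤ z → (x ∨ y) ≤ z
    ∧-lowerˡ : ∀ x y → (x ∧ y) ≤ x
    ∧-lowerʳ : ∀ x y → (x ∧ y) ≤ y
    ∧-greatest : ∀ x y z → z ≤ x → z ≤ y → z ≤ (x ∧ y)

record IsEffectGroupoid {ℓ : Level} (R : Set ℓ) (_·_ : R → R → R)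
                        (_′ : R → R) (𝟘 𝟙 : R) : Set ℓ where
  field
    NG0ˡ : ∀ x → 𝟙 · x ≡ x
    NG0ʳ : ∀ x → x · 𝟙 ≡ x
    NG1  : ∀ x → x ≡ (x ′) ′
    NG2ʳ : ∀ x → x · 𝟘 ≡ 𝟘
    NG2ˡ : ∀ x → 𝟘 · x ≡ 𝟘
    NG3  : 𝟘 ′ ≡ 𝟙
    NG4ˡ : ∀ x y → x · (y · (x ′)) ≡ 𝟘
    NG4ʳ : ∀ x y → (y · (x ′)) · x ≡ 𝟘
    NG5  : ∀ x y → x · y ≡ y · (((((y ′) · (x ′)) ′) · (x ′)) ′)
    NG6ˡ : ∀ x y → x · (((y ′) · x) ′) ≡ (((y ′) · x) ′) · x
    NG6ʳ : ∀ x y → (((y ′) · x) ′) · x ≡ (((x ′) · y) ′) · y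
    NG7  : ∀ x y z → ((((x · (y ′)) ′) · (y ′)) ′) · z
                     ≡ ((((x · z) · ((y · z) ′)) ′) · ((y · z) ′)) ′
    NG8  : ∀ x y z → (x ′) · (y ′) ≡ 𝟘 → ((x · y) ′) · (z ′) ≡ 𝟘 →
           ((y ′) · (z ′) ≡ 𝟘) × ((x ′) · ((y · z) ′) ≡ 𝟘)
             × ((x · y) · z ≡ x · (y · z))

module Submission where

-- Throughout, x · y is the difference y ⊖ (x′ ∧ y): the unique c with
-- (x′ ∧ y) ⊕ c = y.

open import Defs
open import Level using (Level)
open import Data.Maybe using (just)
open import Data.Maybe.Properties using (just-injective)
open import Data.Product using (Σ; _×_; _,_; proj₁; proj₂)
open import Relation.Binary.PropositionalEquality
  using (_≡_; refl; sym; trans; cong; subst; subst₂; module ≡-Reasoning)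

module EffectAlgebraProperties {ℓ : Level} (E : EffectAlgebra ℓ) where
  open EffectAlgebra E

  ⊕-assocʳ : ∀ x y z v w → y ⊕ z ≡ just v → x ⊕ v ≡ just w →
             Σ Carrier λ u → (x ⊕ y ≡ just u) × (u ⊕ z ≡ just w)
  ⊕-assocʳ x y z v w y⊕z x⊕v with E2 z y x v w (E1 y z v y⊕z) (E1 x v w x⊕v)
  ... | u , y⊕x , z⊕u = u , E1 y x u y⊕x , E1 z u w z⊕u

  ′-involutive : ∀ x → x ≡ (x ′) ′
  ′-involutive x = E3-unique (x ′) x (E1 x (x ′) 𝟙 (E3-exists x))

  ⊕-complement : ∀ a b z → a ⊕ b ≡ just z → a ⊕ (z ′) ≡ just (b ′)
  ⊕-complement a b z a⊕b with E2 b a (z ′) z 𝟙 (E1 a b z a⊕b) (E3-exists z)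
  ... | v , a⊕z′ , b⊕v = subst (λ t → a ⊕ (z ′) ≡ just t) (E3-unique b v b⊕v) a⊕z′

  ⊕-cancelˡ : ∀ a b c d → a ⊕ b ≡ just c → a ⊕ d ≡ just c → b ≡ d
  ⊕-cancelˡ a b c d a⊕b a⊕d = begin
    b         ≡⟨ ′-involutive b ⟩
    (b ′) ′   ≡⟨ cong _′ (just-injective (trans (sym (⊕-complement a b c a⊕b))
                                                (⊕-complement a d c a⊕d))) ⟩
    (d ′) ′   ≡⟨ sym (′-involutive d) ⟩
    d         ∎
    where open ≡-Reasoning

  𝟙′≡𝟘 : 𝟙 ′ ≡ 𝟘
  𝟙′≡𝟘 = E4 (𝟙 ′) 𝟙 (E1 𝟙 (𝟙 ′) 𝟙 (E3-exists 𝟙))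

  𝟘⊕𝟙 : 𝟘 ⊕ 𝟙 ≡ just 𝟙
  𝟘⊕𝟙 = subst (λ t → t ⊕ 𝟙 ≡ just 𝟙) 𝟙′≡𝟘 (E1 𝟙 (𝟙 ′) 𝟙 (E3-exists 𝟙))

  𝟘′≡𝟙 : 𝟘 ′ ≡ 𝟙
  𝟘′≡𝟙 = sym (E3-unique 𝟘 𝟙 𝟘⊕𝟙)

  ⊕-identityʳ : ∀ x → x ⊕ 𝟘 ≡ just x
  ⊕-identityʳ x with E2 (x ′) x 𝟘 𝟙 𝟙 (E1 x (x ′) 𝟙 (E3-exists x)) (E1 𝟘 𝟙 𝟙 𝟘⊕𝟙)
  ... | v , x⊕𝟘 , x′⊕v =
    subst (λ t → x ⊕ 𝟘 ≡ just t) (trans (E3-unique (x ′) v x′⊕v) (sym (′-involutive x))) x⊕𝟘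

  ⊕-identityˡ : ∀ x → 𝟘 ⊕ x ≡ just x
  ⊕-identityˡ x = E1 x 𝟘 x (⊕-identityʳ x)

  ⊕-positive : ∀ c d → c ⊕ d ≡ just 𝟘 → c ≡ 𝟘
  ⊕-positive c d c⊕d with E2 d c 𝟙 𝟘 𝟙 (E1 c d 𝟘 c⊕d) 𝟘⊕𝟙
  ... | v , c⊕𝟙 , _ = E4 c v c⊕𝟙

  ≤-refl : ∀ x → x ≤ x
  ≤-refl x = 𝟘 , ⊕-identityʳ x

  ≤-trans : ∀ {a b c} → a ≤ b → b ≤ c → a ≤ c
  ≤-trans {a} (d , a⊕d) (e , b⊕e) with E2 a d e _ _ a⊕d b⊕e
  ... | v , _ , a⊕v = v , a⊕v

  ≤-antisym : ∀ a b → a ≤ b → b ≤ a → a ≡ b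
  ≤-antisym a b (c , a⊕c) (d , b⊕d) with E2 a c d b a a⊕c b⊕d
  ... | v , c⊕d , a⊕v = just-injective (trans (sym (⊕-identityʳ a)) (subst (λ t → a ⊕ t ≡ just b) c≡𝟘 a⊕c))
    where
    v≡𝟘 : v ≡ 𝟘
    v≡𝟘 = ⊕-cancelˡ a v a 𝟘 a⊕v (⊕-identityʳ a)
    c≡𝟘 : c ≡ 𝟘
    c≡𝟘 = ⊕-positive c d (subst (λ t → c ⊕ d ≡ just t) v≡𝟘 c⊕d)

  𝟘-least : ∀ x → 𝟘 ≤ x
  𝟘-least x = x , ⊕-identityˡ x

  ′-antitone : ∀ a b → a ≤ b → (b ′) ≤ (a ′)
  ′-antitone a b (c , a⊕c) with E2 a c (b ′) b 𝟙 a⊕c (E3-exists b)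
  ... | v , c⊕b′ , a⊕v =
    c , E1 c (b ′) (a ′) (subst (λ t → c ⊕ (b ′) ≡ just t) (E3-unique a v a⊕v) c⊕b′)

  ≤-′′ : ∀ {a b} → a ≤ b → a ≤ ((b ′) ′)
  ≤-′′ {a} {b} = subst (a ≤_) (′-involutive b)

  ≤-′′⁻ : ∀ {a b} → a ≤ ((b ′) ′) → a ≤ b
  ≤-′′⁻ {a} {b} = subst (a ≤_) (sym (′-involutive b))

  ′-antitone-swap : ∀ a b → (a ′) ≤ b → (b ′) ≤ a
  ′-antitone-swap a b a′≤b = ≤-′′⁻ (′-antitone (a ′) b a′≤b)

  ⊕-defined⇒≤′ : ∀ a b s → a ⊕ b ≡ just s → b ≤ (a ′)
  ⊕-defined⇒≤′ a b s a⊕b = s ′ , ⊕-complement b a s (E1 a b s a⊕b)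

  ≤′⇒⊕-defined : ∀ a b → a ≤ (b ′) → Σ Carrier λ u → a ⊕ b ≡ just u
  ≤′⇒⊕-defined a b (c , a⊕c) with E2 a c b (b ′) 𝟙 a⊕c (E1 b (b ′) 𝟙 (E3-exists b))
  ... | v , c⊕b , a⊕v with E2 c b a v 𝟙 c⊕b (E1 a v 𝟙 a⊕v)
  ... | u , b⊕a , _ = u , E1 b a u b⊕a

  ⊕-monotone : ∀ c p q P Q → p ≤ q → c ⊕ p ≡ just P → c ⊕ q ≡ just Q → P ≤ Q
  ⊕-monotone c p q P Q (e , p⊕e) c⊕p c⊕q with ⊕-assocʳ c p e q Q p⊕e c⊕q
  ... | u , c⊕p≡u , u⊕e = e , subst (λ t → t ⊕ e ≡ just Q) (just-injective (trans (sym c⊕p≡u) c⊕p)) u⊕e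

  ⊕-reflects-≤ : ∀ c p q P Q → c ⊕ p ≡ just P → c ⊕ q ≡ just Q → P ≤ Q → p ≤ q
  ⊕-reflects-≤ c p q P Q c⊕p c⊕q (e , P⊕e) with E2 c p e P Q c⊕p P⊕e
  ... | v , p⊕e , c⊕v = e , subst (λ t → p ⊕ e ≡ just t) (⊕-cancelˡ c v Q q c⊕v c⊕q) p⊕e

module LatticeEffectAlgebraProperties {ℓ : Level} (L : LatticeEffectAlgebra ℓ) where
  open LatticeEffectAlgebra L
  open EffectAlgebraProperties effectAlgebra

  ∧-of-≤ˡ : ∀ a b → a ≤ b → (a ∧ b) ≡ a
  ∧-of-≤ˡ a b a≤b = ≤-antisym (a ∧ b) a (∧-lowerˡ a b) (∧-greatest a b a (≤-refl a) a≤b)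

  ∧-of-≤ʳ : ∀ a b → b ≤ a → (a ∧ b) ≡ b
  ∧-of-≤ʳ a b b≤a = ≤-antisym (a ∧ b) b (∧-lowerʳ a b) (∧-greatest a b b b≤a (≤-refl b))

  ∧-comm : ∀ a b → (a ∧ b) ≡ (b ∧ a)
  ∧-comm a b = ≤-antisym (a ∧ b) (b ∧ a)
    (∧-greatest b a (a ∧ b) (∧-lowerʳ a b) (∧-lowerˡ a b))
    (∧-greatest a b (b ∧ a) (∧-lowerʳ b a) (∧-lowerˡ b a))

  ∧-∧-distrib : ∀ a b z → ((a ∧ z) ∧ (b ∧ z)) ≡ ((a ∧ b) ∧ z)
  ∧-∧-distrib a b z = ≤-antisym _ _
    (∧-greatest (a ∧ b) z _
      (∧-greatest a b _ (≤-trans (∧-lowerˡ _ _) (∧-lowerˡ a z))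
                        (≤-trans (∧-lowerʳ _ _) (∧-lowerˡ b z)))
      (≤-trans (∧-lowerˡ _ _) (∧-lowerʳ a z)))
    (∧-greatest (a ∧ z) (b ∧ z) _
      (∧-greatest a z _ (≤-trans (∧-lowerˡ _ _) (∧-lowerˡ a b)) (∧-lowerʳ _ _))
      (∧-greatest b z _ (≤-trans (∧-lowerˡ _ _) (∧-lowerʳ a b)) (∧-lowerʳ _ _)))

  -- The meet A ∧ B lies above c, hence is c ⊕ g for some g, and g is a
  -- lower bound of a and b because translations reflect the order.
  ⊕-preserves-∧ : ∀ c a b A B → c ⊕ a ≡ just A → c ⊕ b ≡ just B →
                  Σ Carrier λ D → (c ⊕ (a ∧ b) ≡ just D) × ((A ∧ B) ≡ D)
  ⊕-preserves-∧ c a b A B c⊕a c⊕b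
    with ≤′⇒⊕-defined (a ∧ b) c (≤-trans (∧-lowerˡ a b) (⊕-defined⇒≤′ c a A c⊕a))
       | ∧-greatest A B c (a , c⊕a) (b , c⊕b)
  ... | D , a∧b⊕c | g , c⊕g = D , c⊕a∧b , ≤-antisym (A ∧ B) D A∧B≤D D≤A∧B
    where
    c⊕a∧b : c ⊕ (a ∧ b) ≡ just D
    c⊕a∧b = E1 (a ∧ b) c D a∧b⊕c
    D≤A∧B : D ≤ (A ∧ B)
    D≤A∧B = ∧-greatest A B D (⊕-monotone c (a ∧ b) a D A (∧-lowerˡ a b) c⊕a∧b c⊕a)
                             (⊕-monotone c (a ∧ b) b D B (∧-lowerʳ a b) c⊕a∧b c⊕b)
    g≤a∧b : g ≤ (a ∧ b)
    g≤a∧b = ∧-greatest a b g (⊕-reflects-≤ c g a (A ∧ B) A c⊕g c⊕a (∧-lowerˡ A B))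
                             (⊕-reflects-≤ c g b (A ∧ B) B c⊕g c⊕b (∧-lowerʳ A B))
    A∧B≤D : (A ∧ B) ≤ D
    A∧B≤D = ⊕-monotone c g (a ∧ b) (A ∧ B) D g≤a∧b c⊕g c⊕a∧b

module ProductProperties {ℓ : Level} (L : LatticeEffectAlgebra ℓ) where
  open LatticeEffectAlgebra L
  open EffectAlgebraProperties effectAlgebra
  open LatticeEffectAlgebraProperties L

  product-sum-defined : ∀ x y → Σ Carrier λ z → ((x ′) ∧ y) ⊕ (y ′) ≡ just z
  product-sum-defined x y = ≤′⇒⊕-defined ((x ′) ∧ y) (y ′) (≤-′′ (∧-lowerʳ (x ′) y))

  -- The product  x · y = ((x′ ∧ y) ⊕ y′)′, kept opaque: it is only ever used
  -- through ·-definition, and unfolding the witness makes type checking slow.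
  opaque
    _·_ : Carrier → Carrier → Carrier
    x · y = proj₁ (product-sum-defined x y) ′

    ·-definition : ∀ x y → Σ Carrier λ z → ((((x ′) ∧ y) ⊕ (y ′)) ≡ just z) × ((x · y) ≡ (z ′))
    ·-definition x y = proj₁ (product-sum-defined x y) , proj₂ (product-sum-defined x y) , refl

  ·-difference : ∀ x y → ((x ′) ∧ y) ⊕ (x · y) ≡ just y
  ·-difference x y with ·-definition x y
  ... | z , sum≡z , x·y≡z′ =
    subst₂ (λ s t → ((x ′) ∧ y) ⊕ s ≡ just t) (sym x·y≡z′) (sym (′-involutive y))
           (⊕-complement ((x ′) ∧ y) (y ′) z sum≡z)

  ·-unique : ∀ x y c → ((x ′) ∧ y) ⊕ c ≡ just y → (x · y) ≡ c
  ·-unique x y c = ⊕-cancelˡ ((x ′) ∧ y) (x · y) y c (·-difference x y)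

  ·-≤ʳ : ∀ x y → (x · y) ≤ y
  ·-≤ʳ x y = ((x ′) ∧ y) , E1 ((x ′) ∧ y) (x · y) y (·-difference x y)

  ≤′⇒·≡𝟘 : ∀ x y → y ≤ (x ′) → (x · y) ≡ 𝟘
  ≤′⇒·≡𝟘 x y y≤x′ =
    ·-unique x y 𝟘 (subst (λ t → t ⊕ 𝟘 ≡ just y) (sym (∧-of-≤ʳ (x ′) y y≤x′)) (⊕-identityʳ y))

  ·≡𝟘⇒≤′ : ∀ x y → (x · y) ≡ 𝟘 → y ≤ (x ′)
  ·≡𝟘⇒≤′ x y x·y≡𝟘 = subst (_≤ (x ′)) x′∧y≡y (∧-lowerˡ (x ′) y)
    where
    x′∧y≡y : ((x ′) ∧ y) ≡ y
    x′∧y≡y = just-injective (trans (sym (⊕-identityʳ ((x ′) ∧ y)))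
               (subst (λ t → ((x ′) ∧ y) ⊕ t ≡ just y) x·y≡𝟘 (·-difference x y)))

  ′≤⇒·-difference : ∀ x y → (x ′) ≤ y → (x ′) ⊕ (x · y) ≡ just y
  ′≤⇒·-difference x y x′≤y = subst (λ t → t ⊕ (x · y) ≡ just y) (∧-of-≤ˡ (x ′) y x′≤y) (·-difference x y)

  ·-complement-sum : ∀ a z → (z ′) ⊕ ((a ′) ∧ z) ≡ just ((a · z) ′)
  ·-complement-sum a z =
    E1 ((a ′) ∧ z) (z ′) ((a · z) ′) (⊕-complement ((a ′) ∧ z) (a · z) z (·-difference a z))

  ·-complementˡ : ∀ x y → (((x · y) ′) · y) ≡ ((x ′) ∧ y)
  ·-complementˡ x y = ⊕-cancelˡ (x · y) _ y ((x ′) ∧ y) x·y⊕ (E1 ((x ′) ∧ y) (x · y) y (·-difference x y))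
    where
    x·y⊕ : (x · y) ⊕ (((x · y) ′) · y) ≡ just y
    x·y⊕ = subst (λ t → t ⊕ (((x · y) ′) · y) ≡ just y) (sym (′-involutive (x · y)))
             (′≤⇒·-difference ((x · y) ′) y (subst (_≤ y) (′-involutive (x · y)) (·-≤ʳ x y)))

  ·-complementʳ : ∀ x y → (y · ((x · y) ′)) ≡ ((x ′) ∧ y)
  ·-complementʳ x y =
    ⊕-cancelˡ (y ′) _ ((x · y) ′) ((x ′) ∧ y)
      (′≤⇒·-difference y ((x · y) ′) (′-antitone (x · y) y (·-≤ʳ x y)))
      (E1 ((x ′) ∧ y) (y ′) ((x · y) ′) (⊕-complement ((x ′) ∧ y) (x · y) y (·-difference x y)))

  ·-from-meet : ∀ x y → (y · (((x ′) ∧ y) ′)) ≡ (x · y)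
  ·-from-meet x y =
    ⊕-cancelˡ (y ′) _ (m ′) (x · y)
      (′≤⇒·-difference y (m ′) (′-antitone m y (∧-lowerʳ (x ′) y)))
      (E1 (x · y) (y ′) (m ′) (⊕-complement (x · y) m y (E1 m (x · y) y (·-difference x y))))
    where
    m : Carrier
    m = (x ′) ∧ y

  -- (NG0): 1′ ∧ x = 0 and 0 ⊕ x = x;  x′ ≤ 1 and x′ ⊕ x = 1.
  ·-identityˡ : ∀ x → (𝟙 · x) ≡ x
  ·-identityˡ x = ·-unique 𝟙 x x (subst (λ t → t ⊕ x ≡ just x) (sym 𝟙′∧x≡𝟘) (⊕-identityˡ x))
    where
    𝟙′∧x≡𝟘 : ((𝟙 ′) ∧ x) ≡ 𝟘
    𝟙′∧x≡𝟘 = trans (cong (_∧ x) 𝟙′≡𝟘) (∧-of-≤ˡ 𝟘 x (𝟘-least x))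

  ·-identityʳ : ∀ x → (x · 𝟙) ≡ x
  ·-identityʳ x = trans (E3-unique (x ′) (x · 𝟙) (′≤⇒·-difference x 𝟙 (x , x′⊕x))) (sym (′-involutive x))
    where
    x′⊕x : (x ′) ⊕ x ≡ just 𝟙
    x′⊕x = E1 x (x ′) 𝟙 (E3-exists x)

  ·-zeroʳ : ∀ x → (x · 𝟘) ≡ 𝟘
  ·-zeroʳ x = ≤′⇒·≡𝟘 x 𝟘 (𝟘-least (x ′))

  ·-zeroˡ : ∀ x → (𝟘 · x) ≡ 𝟘
  ·-zeroˡ x = ≤′⇒·≡𝟘 𝟘 x (subst (x ≤_) (sym 𝟘′≡𝟙) (x ′ , E3-exists x))

  -- (NG4): y · x′ ≤ x′, so it is orthogonal to x on either side.
  ·-orthogonalˡ : ∀ x y → (x · (y · (x ′))) ≡ 𝟘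
  ·-orthogonalˡ x y = ≤′⇒·≡𝟘 x (y · (x ′)) (·-≤ʳ y (x ′))

  ·-orthogonalʳ : ∀ x y → ((y · (x ′)) · x) ≡ 𝟘
  ·-orthogonalʳ x y =
    ≤′⇒·≡𝟘 (y · (x ′)) x
      (subst (_≤ ((y · (x ′)) ′)) (sym (′-involutive x)) (′-antitone (y · (x ′)) (x ′) (·-≤ʳ y (x ′))))

  -- (NG5): the inner term equals x′ ∧ y, and y · (x′ ∧ y)′ = x · y.
  ·-exchange : ∀ x y → (x · y) ≡ (y · (((((y ′) · (x ′)) ′) · (x ′)) ′))
  ·-exchange x y = sym (begin
    y · (((((y ′) · (x ′)) ′) · (x ′)) ′)  ≡⟨ cong (λ t → y · (t ′)) (·-complementˡ (y ′) (x ′)) ⟩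
    y · ((((y ′) ′) ∧ (x ′)) ′)             ≡⟨ cong (λ t → y · ((t ∧ (x ′)) ′)) (sym (′-involutive y)) ⟩
    y · ((y ∧ (x ′)) ′)                     ≡⟨ cong (λ t → y · (t ′)) (∧-comm y (x ′)) ⟩
    y · (((x ′) ∧ y) ′)                     ≡⟨ ·-from-meet x y ⟩
    x · y                                   ∎)
    where open ≡-Reasoning

  -- (NG6): all three terms equal x ∧ y.
  ·-balanced : ∀ x y → (x · (((y ′) · x) ′)) ≡ ((((y ′) · x) ′) · x)
  ·-balanced x y = trans (·-complementʳ (y ′) x) (sym (·-complementˡ (y ′) x))

  ·-symmetric : ∀ x y → ((((y ′) · x) ′) · x) ≡ ((((x ′) · y) ′) · y)
  ·-symmetric x y = begin
    (((y ′) · x) ′) · x   ≡⟨ ·-complementˡ (y ′) x ⟩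
    ((y ′) ′) ∧ x         ≡⟨ cong (_∧ x) (sym (′-involutive y)) ⟩
    y ∧ x                 ≡⟨ ∧-comm y x ⟩
    x ∧ y                 ≡⟨ cong (_∧ y) (′-involutive x) ⟩
    ((x ′) ′) ∧ y         ≡⟨ sym (·-complementˡ (x ′) y) ⟩
    (((x ′) · y) ′) · y   ∎
    where open ≡-Reasoning

  -- (NG7): with a = (x′ ∧ y′)′ both sides are a · z, because
  -- (x·z)′ ∧ (y·z)′ = (z′ ⊕ (x′ ∧ z)) ∧ (z′ ⊕ (y′ ∧ z)) = z′ ⊕ ((x′ ∧ y′) ∧ z) = (a·z)′.
  ·-distrib-meet : ∀ x y z → ((((x · (y ′)) ′) · (y ′)) ′) · z
                             ≡ ((((x · z) · ((y · z) ′)) ′) · ((y · z) ′)) ′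
  ·-distrib-meet x y z = begin
    ((((x · (y ′)) ′) · (y ′)) ′) · z             ≡⟨ cong (λ t → (t ′) · z) (·-complementˡ x (y ′)) ⟩
    a · z                                         ≡⟨ ′-involutive (a · z) ⟩
    ((a · z) ′) ′                                 ≡⟨ cong _′ (just-injective (trans (sym (·-complement-sum a z)) z′⊕a′∧z)) ⟩
    D ′                                           ≡⟨ cong _′ (trans (sym meet≡D) (sym (·-complementˡ (x · z) ((y · z) ′)))) ⟩
    ((((x · z) · ((y · z) ′)) ′) · ((y · z) ′)) ′ ∎
    where
    open ≡-Reasoning
    a : Carrier
    a = ((x ′) ∧ (y ′)) ′
    translated : Σ Carrier λ D → ((z ′) ⊕ (((x ′) ∧ z) ∧ ((y ′) ∧ z)) ≡ just D)
                                  × ((((x · z) ′) ∧ ((y · z) ′)) ≡ D)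
    translated = ⊕-preserves-∧ (z ′) ((x ′) ∧ z) ((y ′) ∧ z) ((x · z) ′) ((y · z) ′)
                               (·-complement-sum x z) (·-complement-sum y z)
    D : Carrier
    D = proj₁ translated
    meet≡D : (((x · z) ′) ∧ ((y · z) ′)) ≡ D
    meet≡D = proj₂ (proj₂ translated)
    a′∧z : (((x ′) ∧ z) ∧ ((y ′) ∧ z)) ≡ ((a ′) ∧ z)
    a′∧z = trans (∧-∧-distrib (x ′) (y ′) z) (cong (_∧ z) (′-involutive ((x ′) ∧ (y ′))))
    z′⊕a′∧z : (z ′) ⊕ ((a ′) ∧ z) ≡ just D
    z′⊕a′∧z = subst (λ t → (z ′) ⊕ t ≡ just D) a′∧z (proj₁ (proj₂ translated))

  -- (NG8): the hypotheses say x′ ≤ y and (x·y)′ ≤ z.  Writing y = x′ ⊕ (x·y)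
  -- and z = (x·y)′ ⊕ e, associativity of ⊕ gives z = y′ ⊕ (x′ ⊕ e), so
  -- y · z = x′ ⊕ e, and both (x·y)·z and x·(y·z) are the remainder e.
  ·-assoc-orthogonal : ∀ x y z → ((x ′) · (y ′)) ≡ 𝟘 → (((x · y) ′) · (z ′)) ≡ 𝟘 →
                       (((y ′) · (z ′)) ≡ 𝟘) × (((x ′) · ((y · z) ′)) ≡ 𝟘)
                         × (((x · y) · z) ≡ (x · (y · z)))
  ·-assoc-orthogonal x y z x′·y′≡𝟘 w′·z′≡𝟘 = y′·z′≡𝟘 , x′·[y·z]′≡𝟘 , trans w·z≡e (sym x·[y·z]≡e)
    where
    w : Carrier
    w = x · y
    x′≤y : (x ′) ≤ y
    x′≤y = ′-antitone-swap y x (≤-′′⁻ (·≡𝟘⇒≤′ (x ′) (y ′) x′·y′≡𝟘))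
    z′≤w : (z ′) ≤ w
    z′≤w = ≤-′′⁻ (·≡𝟘⇒≤′ (w ′) (z ′) w′·z′≡𝟘)
    w′≤z : (w ′) ≤ z
    w′≤z = ′-antitone-swap z w z′≤w
    e : Carrier
    e = proj₁ w′≤z
    w′⊕e : (w ′) ⊕ e ≡ just z
    w′⊕e = proj₂ w′≤z
    y′⊕x′ : (y ′) ⊕ (x ′) ≡ just (w ′)
    y′⊕x′ = E1 (x ′) (y ′) (w ′) (⊕-complement (x ′) w y (′≤⇒·-difference x y x′≤y))
    regrouped : Σ Carrier λ v → ((x ′) ⊕ e ≡ just v) × ((y ′) ⊕ v ≡ just z)
    regrouped = E2 (y ′) (x ′) e (w ′) z y′⊕x′ w′⊕e
    y·z≡x′⊕e : (y · z) ≡ proj₁ regrouped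
    y·z≡x′⊕e = ⊕-cancelˡ (y ′) (y · z) z (proj₁ regrouped)
                 (′≤⇒·-difference y z (proj₁ regrouped , proj₂ (proj₂ regrouped)))
                 (proj₂ (proj₂ regrouped))
    x′⊕e : (x ′) ⊕ e ≡ just (y · z)
    x′⊕e = subst (λ t → (x ′) ⊕ e ≡ just t) (sym y·z≡x′⊕e) (proj₁ (proj₂ regrouped))
    y′·z′≡𝟘 : ((y ′) · (z ′)) ≡ 𝟘
    y′·z′≡𝟘 = ≤′⇒·≡𝟘 (y ′) (z ′) (≤-′′ (≤-trans z′≤w (·-≤ʳ x y)))
    x′·[y·z]′≡𝟘 : ((x ′) · ((y · z) ′)) ≡ 𝟘
    x′·[y·z]′≡𝟘 = ≤′⇒·≡𝟘 (x ′) ((y · z) ′) (′-antitone (x ′) (y · z) (e , x′⊕e))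
    w·z≡e : (w · z) ≡ e
    w·z≡e = ⊕-cancelˡ (w ′) (w · z) z e (′≤⇒·-difference w z w′≤z) w′⊕e
    x·[y·z]≡e : (x · (y · z)) ≡ e
    x·[y·z]≡e = ⊕-cancelˡ (x ′) (x · (y · z)) (y · z) e (′≤⇒·-difference x (y · z) (e , x′⊕e)) x′⊕e

  isEffectGroupoid : IsEffectGroupoid Carrier _·_ _′ 𝟘 𝟙
  isEffectGroupoid = record
    { NG0ˡ = ·-identityˡ
    ; NG0ʳ = ·-identityʳ
    ; NG1  = ′-involutive
    ; NG2ʳ = ·-zeroʳ
    ; NG2ˡ = ·-zeroˡ
    ; NG3  = 𝟘′≡𝟙
    ; NG4ˡ = ·-orthogonalˡ
    ; NG4ʳ = ·-orthogonalʳ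
    ; NG5  = ·-exchange
    ; NG6ˡ = ·-balanced
    ; NG6ʳ = ·-symmetric
    ; NG7  = ·-distrib-meet
    ; NG8  = ·-assoc-orthogonal
    }

mainTheorem1 : {ℓ : Level} (L : LatticeEffectAlgebra ℓ) →
    let open LatticeEffectAlgebra L in
    Σ (Carrier → Carrier → Carrier) λ _·_ →
      (∀ x y → Σ Carrier λ z → ((((x ′) ∧ y) ⊕ (y ′)) ≡ just z) × ((x · y) ≡ (z ′)))
      × IsEffectGroupoid Carrier _·_ _′ 𝟘 𝟙
mainTheorem1 L = _·_ , ·-definition , isEffectGroupoid
  where open ProductProperties L
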